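{- Let $p$ be a prime. If $m = 0$ (Pascal's Triangle modulo $p$), or if $p$ is odd and $m = 1$ (Passoja–Lakhtakia carpets), then the set $I = \lim_d I^d$ is a non-trivial self-similar set: there is a $p\times p$ $\{0,1\}$-matrix $D$ with at least one $0$ and at least two $1$'s such that $I^d$ is the black and white image of $D^{\otimes d}$ for all $d \ge 1$.
   Context: For $m\in\mathbb{F}_p$ and $d \ge 1$, $M_d = (a_{i,j})_{0 \le i,j \le p^d-1}$ is the $p^d\times p^d$ matrix over $\mathbb{F}_p$ with $a_{i,0} = a_{0,j} = 1$ and $a_{i,j} = a_{i-1,j} + m\, a_{i-1,j-1} + a_{i,j-1}$ for $i,j\ge1$. The black and white image of an $N\times N$ matrix $(b_{i,j})$ is the subset of $[0,1]^2$ obtained by tiling it into $N\times N$ equal closed squares $S_{i,j}$ and removing the interior of $S_{i,j}$ exactly when $b_{i,j}=0$; $I^d$ is the image of $M_d$ and $I=\lim I^d$ in the Hausdorff metric. $A\otimes B = (a_{i,j}B)$, $D^{\otimes1}=D$, $D^{\otimes(d+1)}=D^{\otimes d}\otimes D$. -}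

module Defs where

open import Data.Nat using (ℕ; zero; suc; _+_; _*_; _/_; NonZero)
open import Data.Nat.DivMod using (_mod_)
open import Data.Fin using (Fin)
open import Data.Bool using (Bool; true; false; _∧_)

-- Entries of the (infinite) matrix a_{i,j} over ℕ (integer lift):
-- a_{i,0} = a_{0,j} = 1, a_{i,j} = a_{i-1,j} + m a_{i-1,j-1} + a_{i,j-1}.
-- The entry of M_d over F_p is the residue mod p of this natural number,
-- so (M_d)_{i,j} = 0 in F_p  iff  p ∣ entry m i j.
entry : ℕ → ℕ → ℕ → ℕ
entry m zero    j       = 1
entry m (suc i) zero    = 1
entry m (suc i) (suc j) = entry m i (suc j) + m * entry m i j + entry m (suc i) j

-- Kronecker power D^{⊗d} of a p×p {0,1}-matrix D (true = 1, false = 0),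
-- indexed by naturals i, j < p^d.  D^{⊗1} = D, D^{⊗(d+1)} = D^{⊗d} ⊗ D,
-- where (A ⊗ B)_{i p + i', j p + j'} = A_{i,j} B_{i',j'}.
-- (The d = 0 case is the 1×1 matrix [1]; it is never used by the statement.)
kronPow : (p : ℕ) .{{_ : NonZero p}} → (Fin p → Fin p → Bool) → ℕ → ℕ → ℕ → Bool
kronPow p D zero          i j = true
kronPow p D (suc zero)    i j = D (i mod p) (j mod p)
kronPow p D (suc (suc d)) i j = kronPow p D (suc d) (i / p) (j / p) ∧ D (i mod p) (j mod p)

{-# OPTIONS --safe #-}

-- With t = m + 1 the entries have the closed form a_{i,j} = Σ_k C(i,k) C(j,k) t^k.
-- As p divides C(p,k) for 0 < k < p and t^p ≡ t (mod p), row p is ≡ 1 in the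
-- columns j < p and a_{p,p} ≡ 1 + t.  Through the recurrence this says that, with
-- q = p - 1, a_{q,j+1} + m a_{q,j} ≡ 0 for j + 1 < p and m a_{q,q} ≡ m, which are
-- exactly the relations making the recurrence factor over p × p blocks:
-- a_{r+Ip,s+Jp} ≡ a_{I,J} a_{r,s} for r, s < p.  Since p is prime, p divides a
-- product iff it divides a factor, so by induction on d the zero pattern of M_d is
-- the d-th Kronecker power of the zero pattern D of M_1.  The first row of D is all
-- ones, and D has a zero at (1, k) when a_{1,k} = 1 + k t = p, i.e. at k = p - 1
-- for m = 0 and at k = (p - 1)/2 for m = 1 and p odd.

module Submission where

open import Defs
open import Data.Nat using (ℕ; zero; suc; _+_; _*_; _∸_; _^_; _<_; _≤_; _/_; _%_; pred; NonZero; z≤n; s≤s; z<s; s<s)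
open import Data.Nat.Properties
open import Data.Nat.DivMod using (_mod_; %-distribˡ-+; %-distribˡ-*; [m+kn]%n≡m%n; m%n<n; m≡m%n+[m/n]*n; m<n⇒m%n≡m; m<n*o⇒m/o<n)
open import Data.Nat.Divisibility hiding (quotient)
open import Data.Nat.Primality using (Prime; euclidsLemma)
open import Data.Nat.Combinatorics using (_C_; nCn≡1; nC1≡n; k>n⇒nCk≡0; nCk+nC[k+1]≡[n+1]C[k+1])
open import Data.Nat.Tactic.RingSolver using (solve-∀)
open import Data.Fin using (Fin; toℕ; fromℕ<) renaming (zero to fzero; suc to fsuc)
open import Data.Fin.Properties using (toℕ-fromℕ<; toℕ-inject₁; toℕ-fromℕ)
open import Data.Bool using (Bool; true; false; _∧_)
open import Data.Product using (_×_; _,_; ∃-syntax)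
open import Data.Sum using (_⊎_; inj₁; inj₂; [_,_])
open import Data.Sum.Function.Propositional using (_⊎-⇔_)
open import Function using (_∘_; case_of_)
open import Function.Bundles using (_⇔_; mk⇔; Equivalence)
open import Function.Properties.Equivalence using (⇔-setoid) renaming (sym to ⇔-sym)
open import Level using (0ℓ)
open import Relation.Nullary using (¬_; Dec; yes; no; contradiction)
open import Relation.Nullary.Decidable using (isNo)
open import Relation.Binary using (Setoid; IsEquivalence)
open import Relation.Binary.PropositionalEquality using (_≡_; refl; sym; trans; cong; cong₂; subst; subst₂; module ≡-Reasoning)
import Relation.Binary.Reasoning.Setoid as SetoidReasoning
open import Algebra.Properties.Semiring.Sum +-*-semiring
  using (sum; sum-cong-≗; ∑-distrib-+; *-distribˡ-sum; sum-init-last; sum-replicate-zero)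
import Algebra.Properties.CommutativeSemiring.Binomial +-*-commutativeSemiring as Binomial
import Algebra.Properties.Semiring.Exp +-*-semiring as Exp
import Algebra.Properties.Semiring.Mult +-*-semiring as Mult

private
  variable
    a b c d : ℕ

sumTo : ℕ → (ℕ → ℕ) → ℕ
sumTo n f = sum {n} (λ k → f (toℕ k))

sumTo-cong : ∀ n {f g : ℕ → ℕ} → (∀ k → f k ≡ g k) → sumTo n f ≡ sumTo n g
sumTo-cong n f≗g = sum-cong-≗ {n} (f≗g ∘ toℕ)

sumTo-+ : ∀ n (f g : ℕ → ℕ) → sumTo n (λ k → f k + g k) ≡ sumTo n f + sumTo n g
sumTo-+ n f g = ∑-distrib-+ {n} (f ∘ toℕ) (g ∘ toℕ)

*-distribˡ-sumTo : ∀ n c (f : ℕ → ℕ) → c * sumTo n f ≡ sumTo n (λ k → c * f k)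
*-distribˡ-sumTo n c f = *-distribˡ-sum {n} c (f ∘ toℕ)

sumTo-last : ∀ n (f : ℕ → ℕ) → sumTo (suc n) f ≡ sumTo n f + f n
sumTo-last n f = trans (sum-init-last {n} (f ∘ toℕ))
  (cong₂ _+_ (sum-cong-≗ {n} (cong f ∘ toℕ-inject₁)) (cong f (toℕ-fromℕ n)))

shift : (ℕ → ℕ) → ℕ → ℕ
shift f zero    = 0
shift f (suc k) = f k

∣-sumTo : ∀ n (f : ℕ → ℕ) → (∀ k → k < n → d ∣ f k) → d ∣ sumTo n f
∣-sumTo zero    f d∣f = _ ∣0
∣-sumTo (suc n) f d∣f =
  ∣m∣n⇒∣m+n (d∣f 0 z<s) (∣-sumTo n (f ∘ suc) (λ k k<n → d∣f (suc k) (s<s k<n)))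

[1+k]*[1+n]C[1+k]≡[1+n]*nCk : ∀ n k → suc k * (suc n C suc k) ≡ suc n * (n C k)
[1+k]*[1+n]C[1+k]≡[1+n]*nCk zero    zero    = refl
[1+k]*[1+n]C[1+k]≡[1+n]*nCk zero    (suc k) =
  trans (cong (suc (suc k) *_) (k>n⇒nCk≡0 {1} {suc (suc k)} (s<s z<s))) (*-zeroʳ (suc (suc k)))
[1+k]*[1+n]C[1+k]≡[1+n]*nCk (suc n) zero    =
  trans (*-identityˡ _) (trans (nC1≡n (suc (suc n))) (sym (*-identityʳ (suc (suc n)))))
[1+k]*[1+n]C[1+k]≡[1+n]*nCk (suc n) (suc k) = begin
  suc (suc k) * (suc (suc n) C suc (suc k))
    ≡⟨ cong (suc (suc k) *_) (sym (nCk+nC[k+1]≡[n+1]C[k+1] (suc n) (suc k))) ⟩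
  suc (suc k) * (x + y)
    ≡⟨ distribute k x y ⟩
  x + suc k * x + suc (suc k) * y
    ≡⟨ cong₂ (λ u v → x + u + v) ([1+k]*[1+n]C[1+k]≡[1+n]*nCk n k) ([1+k]*[1+n]C[1+k]≡[1+n]*nCk n (suc k)) ⟩
  x + suc n * (n C k) + suc n * (n C suc k)
    ≡⟨ +-assoc x _ _ ⟩
  x + (suc n * (n C k) + suc n * (n C suc k))
    ≡⟨ cong (x +_) (sym (*-distribˡ-+ (suc n) (n C k) (n C suc k))) ⟩
  x + suc n * (n C k + n C suc k)
    ≡⟨ cong (λ z → x + suc n * z) (nCk+nC[k+1]≡[n+1]C[k+1] n k) ⟩
  suc (suc n) * x ∎
  where
  open ≡-Reasoning
  x = suc n C suc k
  y = suc n C suc (suc k)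
  distribute : ∀ k x y → suc (suc k) * (x + y) ≡ x + suc k * x + suc (suc k) * y
  distribute = solve-∀

prime∣pC[1+k] : ∀ {n k} → Prime (suc n) → k < n → suc n ∣ suc n C suc k
prime∣pC[1+k] {n} {k} isPrime k<n with euclidsLemma (suc k) (suc n C suc k) isPrime
  (subst (suc n ∣_) (sym ([1+k]*[1+n]C[1+k]≡[1+n]*nCk n k)) (m∣m*n (n C k)))
... | inj₁ p∣1+k = contradiction (∣⇒≤ p∣1+k) (<⇒≱ (s<s k<n))
... | inj₂ p∣pC[1+k] = p∣pC[1+k]

binomialTheorem : ∀ n x → (x + 1) ^ n ≡ sumTo (suc n) (λ k → (n C k) * x ^ k)
binomialTheorem n x = begin
  (x + 1) ^ n                      ≡⟨ sym (^≡^ (x + 1) n) ⟩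
  (x + 1) Exp.^ n                  ≡⟨ Binomial.theorem n x 1 ⟩
  Binomial.binomialExpansion x 1 n ≡⟨ sum-cong-≗ {suc n} term ⟩
  sumTo (suc n) (λ k → (n C k) * x ^ k) ∎
  where
  open ≡-Reasoning
  ^≡^ : ∀ y n → y Exp.^ n ≡ y ^ n
  ^≡^ y zero    = refl
  ^≡^ y (suc n) = cong (y *_) (^≡^ y n)
  ×≡* : ∀ n y → n Mult.× y ≡ n * y
  ×≡* zero    y = refl
  ×≡* (suc n) y = cong (y +_) (×≡* n y)
  term : ∀ k → Binomial.binomialTerm x 1 n k ≡ (n C toℕ k) * x ^ toℕ k
  term k = trans (×≡* (n C toℕ k) _) (cong ((n C toℕ k) *_) (begin
    x Exp.^ toℕ k * 1 Exp.^ (n ∸ toℕ k) ≡⟨ cong₂ _*_ (^≡^ x (toℕ k)) (trans (^≡^ 1 (n ∸ toℕ k)) (^-zeroˡ (n ∸ toℕ k))) ⟩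
    x ^ toℕ k * 1                        ≡⟨ *-identityʳ (x ^ toℕ k) ⟩
    x ^ toℕ k ∎))

isNo≡false⇔ : ∀ {A : Set} (A? : Dec A) → isNo A? ≡ false ⇔ A
isNo≡false⇔ (yes a) = mk⇔ (λ _ → a) (λ _ → refl)
isNo≡false⇔ (no ¬a) = mk⇔ (λ ()) (λ a → contradiction a ¬a)

isNo≡true : ∀ {A : Set} (A? : Dec A) → ¬ A → isNo A? ≡ true
isNo≡true (yes a) ¬a = contradiction a ¬a
isNo≡true (no _)  _  = refl

∧≡false⇔ : ∀ {x y} → x ∧ y ≡ false ⇔ (x ≡ false ⊎ y ≡ false)
∧≡false⇔ {false} = mk⇔ inj₁ (λ _ → refl)
∧≡false⇔ {true}  = mk⇔ inj₂ [ (λ ()) , (λ y≡false → y≡false) ]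

prime∣*⇔ : ∀ {p} → Prime p → p ∣ a * b ⇔ (p ∣ a ⊎ p ∣ b)
prime∣*⇔ {a} {b} isPrime = mk⇔ (euclidsLemma a b isPrime) [ ∣m⇒∣m*n b , ∣n⇒∣m*n a ]

module Congruence (n : ℕ) .{{_ : NonZero n}} where

  -- A record rather than a synonym for x % n ≡ y % n, so that x and y are
  -- determined by a proof and need not be given explicitly.
  infix 4 _≈_
  record _≈_ (x y : ℕ) : Set where
    constructor mk≈
    field %-≡ : x % n ≡ y % n

  ≈-isEquivalence : IsEquivalence _≈_
  ≈-isEquivalence = record
    { refl  = mk≈ refl
    ; sym   = λ (mk≈ x≡y) → mk≈ (sym x≡y)
    ; trans = λ (mk≈ x≡y) (mk≈ y≡z) → mk≈ (trans x≡y y≡z)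
    }

  open IsEquivalence ≈-isEquivalence public
    using () renaming (refl to ≈-refl; sym to ≈-sym; trans to ≈-trans; reflexive to ≈-reflexive)

  setoid : Setoid 0ℓ 0ℓ
  setoid = record { isEquivalence = ≈-isEquivalence }

  +-cong : a ≈ b → c ≈ d → a + c ≈ b + d
  +-cong {a} {b} {c} {d} (mk≈ a≡b) (mk≈ c≡d) = mk≈ (begin
    (a + c) % n             ≡⟨ %-distribˡ-+ a c n ⟩
    (a % n + c % n) % n     ≡⟨ cong₂ (λ x y → (x + y) % n) a≡b c≡d ⟩
    (b % n + d % n) % n     ≡⟨ %-distribˡ-+ b d n ⟨
    (b + d) % n ∎)
    where open ≡-Reasoning

  *-cong : a ≈ b → c ≈ d → a * c ≈ b * d
  *-cong {a} {b} {c} {d} (mk≈ a≡b) (mk≈ c≡d) = mk≈ (begin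
    (a * c) % n             ≡⟨ %-distribˡ-* a c n ⟩
    (a % n * (c % n)) % n   ≡⟨ cong₂ (λ x y → (x * y) % n) a≡b c≡d ⟩
    (b % n * (d % n)) % n   ≡⟨ %-distribˡ-* b d n ⟨
    (b * d) % n ∎)
    where open ≡-Reasoning

  n∣b⇒a+b≈a : ∀ a → n ∣ b → a + b ≈ a
  n∣b⇒a+b≈a a (divides k refl) = mk≈ ([m+kn]%n≡m%n a k n)

  +-cancelʳ-≈ : ∀ a b c → a + c ≈ b + c → a ≈ b
  +-cancelʳ-≈ a b c a+c≈b+c = begin
    a                  ≈⟨ n∣b⇒a+b≈a a (n∣m*n c) ⟨
    a + c * n          ≡⟨ regroup a ⟩
    a + c + c * pred n ≈⟨ +-cong a+c≈b+c ≈-refl ⟩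
    b + c + c * pred n ≡⟨ regroup b ⟨
    b + c * n          ≈⟨ n∣b⇒a+b≈a b (n∣m*n c) ⟩
    b ∎
    where
    open SetoidReasoning setoid
    regroup : ∀ x → x + c * n ≡ x + c + c * pred n
    regroup x = trans (cong (λ k → x + c * k) (sym (suc-pred n)))
                      (trans (cong (x +_) (*-suc c (pred n))) (sym (+-assoc x c _)))

  a+c*b≈a : ∀ a c → b ≈ 0 → a + c * b ≈ a
  a+c*b≈a a c b≈0 = ≈-trans (+-cong (≈-refl {a}) (*-cong (≈-refl {c}) b≈0))
                            (≈-reflexive (trans (cong (a +_) (*-zeroʳ c)) (+-identityʳ a)))

  ∣-cong-≈ : a ≈ b → n ∣ a ⇔ n ∣ b
  ∣-cong-≈ {a} {b} (mk≈ a≡b) = mk⇔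
    (λ n∣a → m%n≡0⇒n∣m b n (trans (sym a≡b) (n∣m⇒m%n≡0 a n n∣a)))
    (λ n∣b → m%n≡0⇒n∣m a n (trans a≡b (n∣m⇒m%n≡0 b n n∣b)))

-- The matrix entries and their closed form

entry[i,0]≡1 : ∀ m i → entry m i 0 ≡ 1
entry[i,0]≡1 m zero    = refl
entry[i,0]≡1 m (suc i) = refl

entry-sym : ∀ m i j → entry m i j ≡ entry m j i
entry-sym m zero    zero    = refl
entry-sym m zero    (suc j) = refl
entry-sym m (suc i) zero    = refl
entry-sym m (suc i) (suc j) = begin
  entry m i (suc j) + m * entry m i j + entry m (suc i) j
    ≡⟨ cong₂ (λ x y → x + m * y + entry m (suc i) j) (entry-sym m i (suc j)) (entry-sym m i j) ⟩
  entry m (suc j) i + m * entry m j i + entry m (suc i) j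
    ≡⟨ cong (entry m (suc j) i + m * entry m j i +_) (entry-sym m (suc i) j) ⟩
  entry m (suc j) i + m * entry m j i + entry m j (suc i)
    ≡⟨ swap (entry m (suc j) i) (m * entry m j i) (entry m j (suc i)) ⟩
  entry m j (suc i) + m * entry m j i + entry m (suc j) i ∎
  where
  open ≡-Reasoning
  swap : ∀ x y z → x + y + z ≡ z + y + x
  swap = solve-∀

entry[1,j]≡1+j*[1+m] : ∀ m j → entry m 1 j ≡ suc (j * suc m)
entry[1,j]≡1+j*[1+m] m zero    = refl
entry[1,j]≡1+j*[1+m] m (suc j) =
  cong suc (trans (cong (m * 1 +_) (entry[1,j]≡1+j*[1+m] m j)) (regroup m (j * suc m)))
  where
  regroup : ∀ m x → m * 1 + suc x ≡ suc (m + x)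
  regroup = solve-∀

entryTerm : ℕ → ℕ → ℕ → ℕ → ℕ
entryTerm m i j k = (i C k) * suc m ^ k * (j C k)

-- Pascal's rule splits both binomial coefficients; the product of the two shifted
-- halves is (m + 1) times the (i, j) term at k - 1.
entryTerm-pascal : ∀ m i j k →
  entryTerm m (suc i) (suc j) k + entryTerm m i j k ≡
  entryTerm m i (suc j) k + entryTerm m (suc i) j k + shift (λ l → suc m * entryTerm m i j l) k
entryTerm-pascal m i j zero    = refl
entryTerm-pascal m i j (suc k)
  rewrite sym (nCk+nC[k+1]≡[n+1]C[k+1] i k) | sym (nCk+nC[k+1]≡[n+1]C[k+1] j k) =
  expand (i C k) (i C suc k) (j C k) (j C suc k) (suc m) (suc m ^ k)
  where
  expand : ∀ a′ a c′ c t x →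
    (a′ + a) * (t * x) * (c′ + c) + a * (t * x) * c ≡
    a * (t * x) * (c′ + c) + (a′ + a) * (t * x) * c + t * (a′ * x * c′)
  expand = solve-∀

sumTo-entryTerm-recurrence : ∀ m {n} i j → i < n →
  sumTo (suc n) (entryTerm m (suc i) (suc j)) ≡
  sumTo (suc n) (entryTerm m i (suc j)) + m * sumTo (suc n) (entryTerm m i j) + sumTo (suc n) (entryTerm m (suc i) j)
sumTo-entryTerm-recurrence m {n} i j i<n = +-cancelʳ-≡ (Σ T) _ _ (begin
  Σ T₁₁ + Σ T                                  ≡⟨ sumTo-+ (suc n) T₁₁ T ⟨
  Σ (λ k → T₁₁ k + T k)                        ≡⟨ sumTo-cong (suc n) (entryTerm-pascal m i j) ⟩
  Σ (λ k → T₀₁ k + T₁₀ k + shift tT k)         ≡⟨ sumTo-+ (suc n) (λ k → T₀₁ k + T₁₀ k) (shift tT) ⟩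
  Σ (λ k → T₀₁ k + T₁₀ k) + Σ (shift tT)       ≡⟨ cong₂ _+_ (sumTo-+ (suc n) T₀₁ T₁₀) Σ[shift-tT]≡t*ΣT ⟩
  Σ T₀₁ + Σ T₁₀ + suc m * Σ T                  ≡⟨ regroup m (Σ T₀₁) (Σ T₁₀) (Σ T) ⟩
  Σ T₀₁ + m * Σ T + Σ T₁₀ + Σ T                ∎)
  where
  open ≡-Reasoning
  Σ = sumTo (suc n)
  T T₀₁ T₁₀ T₁₁ tT : ℕ → ℕ
  T   = entryTerm m i j
  T₀₁ = entryTerm m i (suc j)
  T₁₀ = entryTerm m (suc i) j
  T₁₁ = entryTerm m (suc i) (suc j)
  tT k = suc m * T k
  Σ[shift-tT]≡t*ΣT : Σ (shift tT) ≡ suc m * Σ T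
  Σ[shift-tT]≡t*ΣT = begin
    Σ (shift tT)               ≡⟨⟩
    sumTo n tT                 ≡⟨ *-distribˡ-sumTo n (suc m) T ⟨
    suc m * sumTo n T          ≡⟨ cong (suc m *_) (+-identityʳ (sumTo n T)) ⟨
    suc m * (sumTo n T + 0)    ≡⟨ cong (λ x → suc m * (sumTo n T + x * suc m ^ n * (j C n))) (k>n⇒nCk≡0 i<n) ⟨
    suc m * (sumTo n T + T n)  ≡⟨ cong (suc m *_) (sumTo-last n T) ⟨
    suc m * Σ T                ∎
  regroup : ∀ m x y z → x + y + suc m * z ≡ x + m * z + y + z
  regroup = solve-∀

-- The range n is any bound above i, so that the three sums in the recurrence share it.
entry≡sumTo : ∀ m {n} i j → i < n → entry m i j ≡ sumTo n (entryTerm m i j)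
entry≡sumTo m {suc n} zero    j       _ = cong suc (sym (sum-replicate-zero n))
entry≡sumTo m {suc n} (suc i) zero    _ =
  cong suc (sym (trans (sumTo-cong n (λ k → *-zeroʳ ((suc i C suc k) * suc m ^ suc k))) (sum-replicate-zero n)))
entry≡sumTo m {suc n} (suc i) (suc j) (s<s i<n) = begin
  entry m i (suc j) + m * entry m i j + entry m (suc i) j
    ≡⟨ cong₂ (λ x y → x + m * y + entry m (suc i) j) (entry≡sumTo m i (suc j) i<1+n) (entry≡sumTo m i j i<1+n) ⟩
  Σ (entryTerm m i (suc j)) + m * Σ (entryTerm m i j) + entry m (suc i) j
    ≡⟨ cong (Σ (entryTerm m i (suc j)) + m * Σ (entryTerm m i j) +_) (entry≡sumTo m (suc i) j (s<s i<n)) ⟩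
  Σ (entryTerm m i (suc j)) + m * Σ (entryTerm m i j) + Σ (entryTerm m (suc i) j)
    ≡⟨ sumTo-entryTerm-recurrence m i j i<n ⟨
  Σ (entryTerm m (suc i) (suc j)) ∎
  where
  open ≡-Reasoning
  Σ = sumTo (suc n)
  i<1+n = m<n⇒m<1+n i<n

nonzeroPattern : (p : ℕ) → ℕ → Fin p → Fin p → Bool
nonzeroPattern p m r s = isNo (p ∣? entry m (toℕ r) (toℕ s))

-- Modulo a prime p

module _ {q : ℕ} (isPrime : Prime (suc q)) where

  private
    p = suc q

    q<p : q < p
    q<p = n<1+n q

  open Congruence p

  sum-pCk*g≈g0+gp : ∀ (g : ℕ → ℕ) → sumTo (suc p) (λ k → (p C k) * g k) ≈ g 0 + g p
  sum-pCk*g≈g0+gp g = begin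
    sumTo (suc p) (λ k → (p C k) * g k)       ≡⟨⟩
    1 * g 0 + sumTo p inner                   ≡⟨ cong₂ _+_ (*-identityˡ (g 0)) (sumTo-last q inner) ⟩
    g 0 + (sumTo q inner + inner q)           ≡⟨ regroup (g 0) (sumTo q inner) (inner q) ⟩
    g 0 + inner q + sumTo q inner             ≈⟨ n∣b⇒a+b≈a _ (∣-sumTo q inner p∣inner) ⟩
    g 0 + (p C p) * g p                       ≡⟨ cong (λ x → g 0 + x * g p) (nCn≡1 p) ⟩
    g 0 + 1 * g p                             ≡⟨ cong (g 0 +_) (*-identityˡ (g p)) ⟩
    g 0 + g p ∎
    where
    open SetoidReasoning setoid
    inner : ℕ → ℕ
    inner k = (p C suc k) * g (suc k)
    p∣inner : ∀ k → k < q → p ∣ inner k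
    p∣inner k k<q = ∣m⇒∣m*n (g (suc k)) (prime∣pC[1+k] isPrime k<q)
    regroup : ∀ x y z → x + (y + z) ≡ x + z + y
    regroup = solve-∀

  a^p≈a : ∀ a → a ^ p ≈ a
  a^p≈a zero    = ≈-refl
  a^p≈a (suc a) = begin
    suc a ^ p                              ≡⟨ cong (_^ p) (+-comm 1 a) ⟩
    (a + 1) ^ p                            ≡⟨ binomialTheorem p a ⟩
    sumTo (suc p) (λ k → (p C k) * a ^ k)  ≈⟨ sum-pCk*g≈g0+gp (a ^_) ⟩
    1 + a ^ p                              ≈⟨ +-cong (≈-refl {1}) (a^p≈a a) ⟩
    1 + a ∎
    where open SetoidReasoning setoid

  entry[p,j]≈1+[1+m]^p*jCp : ∀ m j → entry m p j ≈ 1 + suc m ^ p * (j C p)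
  entry[p,j]≈1+[1+m]^p*jCp m j = begin
    entry m p j                                            ≡⟨ entry≡sumTo m p j (n<1+n p) ⟩
    sumTo (suc p) (entryTerm m p j)                        ≡⟨ sumTo-cong (suc p) (λ k → *-assoc (p C k) (suc m ^ k) (j C k)) ⟩
    sumTo (suc p) (λ k → (p C k) * (suc m ^ k * (j C k)))  ≈⟨ sum-pCk*g≈g0+gp (λ k → suc m ^ k * (j C k)) ⟩
    1 + suc m ^ p * (j C p) ∎
    where open SetoidReasoning setoid

  entry[p,j]≈1 : ∀ m {j} → j < p → entry m p j ≈ 1
  entry[p,j]≈1 m {j} j<p = ≈-trans (entry[p,j]≈1+[1+m]^p*jCp m j) (≈-reflexive (begin
    1 + suc m ^ p * (j C p) ≡⟨ cong (λ x → 1 + suc m ^ p * x) (k>n⇒nCk≡0 j<p) ⟩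
    1 + suc m ^ p * 0       ≡⟨ cong (1 +_) (*-zeroʳ (suc m ^ p)) ⟩
    1 ∎))
    where open ≡-Reasoning

  entry[p,p]≈2+m : ∀ m → entry m p p ≈ 2 + m
  entry[p,p]≈2+m m = begin
    entry m p p               ≈⟨ entry[p,j]≈1+[1+m]^p*jCp m p ⟩
    1 + suc m ^ p * (p C p)   ≡⟨ cong (λ x → 1 + suc m ^ p * x) (nCn≡1 p) ⟩
    1 + suc m ^ p * 1         ≡⟨ cong (1 +_) (*-identityʳ (suc m ^ p)) ⟩
    1 + suc m ^ p             ≈⟨ +-cong (≈-refl {1}) (a^p≈a (suc m)) ⟩
    2 + m ∎
    where open SetoidReasoning setoid

  entry[q,1+j]+m*entry[q,j]≈0 : ∀ m {j} → suc j < p → entry m q (suc j) + m * entry m q j ≈ 0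
  entry[q,1+j]+m*entry[q,j]≈0 m {j} 1+j<p = +-cancelʳ-≈ _ 0 (entry m p j) (begin
    entry m p (suc j) ≈⟨ entry[p,j]≈1 m 1+j<p ⟩
    1                 ≈⟨ entry[p,j]≈1 m (<⇒≤ 1+j<p) ⟨
    entry m p j ∎)
    where open SetoidReasoning setoid

  m*entry[i,q]+entry[1+i,q]≈0 : ∀ m {i} → suc i < p → m * entry m i q + entry m (suc i) q ≈ 0
  m*entry[i,q]+entry[1+i,q]≈0 m {i} 1+i<p = ≈-trans (≈-reflexive (begin
    m * entry m i q + entry m (suc i) q ≡⟨ cong₂ (λ x y → m * x + y) (entry-sym m i q) (entry-sym m (suc i) q) ⟩
    m * entry m q i + entry m q (suc i) ≡⟨ +-comm (m * entry m q i) _ ⟩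
    entry m q (suc i) + m * entry m q i ∎))
    (entry[q,1+j]+m*entry[q,j]≈0 m 1+i<p)
    where open ≡-Reasoning

  m*entry[q,q]≈m : ∀ m → m * entry m q q ≈ m
  m*entry[q,q]≈m m = +-cancelʳ-≈ _ m 2 (begin
    m * entry m q q + 2                                 ≡⟨ regroup (m * entry m q q) ⟩
    1 + m * entry m q q + 1                             ≈⟨ +-cong (+-cong entry[q,p]≈1 ≈-refl) (entry[p,j]≈1 m q<p) ⟨
    entry m q p + m * entry m q q + entry m p q         ≈⟨ entry[p,p]≈2+m m ⟩
    2 + m                                               ≡⟨ +-comm 2 m ⟩
    m + 2 ∎)
    where
    open SetoidReasoning setoid
    entry[q,p]≈1 : entry m q p ≈ 1
    entry[q,p]≈1 = ≈-trans (≈-reflexive (entry-sym m q p)) (entry[p,j]≈1 m q<p)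
    regroup : ∀ x → x + 2 ≡ 1 + x + 1
    regroup = solve-∀

  module _ (m : ℕ) where

    private
      e : ℕ → ℕ → ℕ
      e = entry m

    entry-recurrence-≈ : ∀ i j {x y z} → e i (suc j) ≈ x → e i j ≈ y → e (suc i) j ≈ z →
                         e (suc i) (suc j) ≈ x + m * y + z
    entry-recurrence-≈ _ _ x≈ y≈ z≈ = +-cong (+-cong x≈ (*-cong (≈-refl {m}) y≈)) z≈

    column-boundary : ∀ {r} → suc r < p → ∀ x y →
                      x * e r 0 + m * (y * e r q) + y * e (suc r) q ≈ x * 1
    column-boundary {r} 1+r<p x y = begin
      x * e r 0 + m * (y * e r q) + y * e (suc r) q ≡⟨ cong (λ z → x * z + m * (y * e r q) + y * e (suc r) q) (entry[i,0]≡1 m r) ⟩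
      x * 1 + m * (y * e r q) + y * e (suc r) q     ≡⟨ regroup m (x * 1) y (e r q) (e (suc r) q) ⟩
      x * 1 + y * (m * e r q + e (suc r) q)         ≈⟨ a+c*b≈a (x * 1) y (m*entry[i,q]+entry[1+i,q]≈0 m 1+r<p) ⟩
      x * 1                                         ∎
      where
      open SetoidReasoning setoid
      regroup : ∀ m a c u v → a + m * (c * u) + c * v ≡ a + c * (m * u + v)
      regroup = solve-∀

    row-boundary : ∀ {s} → suc s < p → ∀ x y →
                   y * e q (suc s) + m * (y * e q s) + x * 1 ≈ x * 1
    row-boundary {s} 1+s<p x y = begin
      y * e q (suc s) + m * (y * e q s) + x * 1 ≡⟨ regroup m (x * 1) y (e q (suc s)) (e q s) ⟩
      x * 1 + y * (e q (suc s) + m * e q s)     ≈⟨ a+c*b≈a (x * 1) y (entry[q,1+j]+m*entry[q,j]≈0 m 1+s<p) ⟩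
      x * 1                                     ∎
      where
      open SetoidReasoning setoid
      regroup : ∀ m a c u v → c * u + m * (c * v) + a ≡ a + c * (u + m * v)
      regroup = solve-∀

    corner-boundary : ∀ x y z → x * e q 0 + m * (y * e q q) + z * 1 ≈ (x + m * y + z) * 1
    corner-boundary x y z = begin
      x * e q 0 + m * (y * e q q) + z * 1 ≡⟨ cong (λ w → x * w + m * (y * e q q) + z * 1) (entry[i,0]≡1 m q) ⟩
      x * 1 + m * (y * e q q) + z * 1     ≡⟨ regroup m x y z (e q q) ⟩
      x * 1 + y * (m * e q q) + z * 1     ≈⟨ +-cong (+-cong (≈-refl {x * 1}) (*-cong (≈-refl {y}) (m*entry[q,q]≈m m))) ≈-refl ⟩
      x * 1 + y * m + z * 1               ≡⟨ collect m x y z ⟩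
      (x + m * y + z) * 1                 ∎
      where
      open SetoidReasoning setoid
      regroup : ∀ m x y z w → x * 1 + m * (y * w) + z * 1 ≡ x * 1 + y * (m * w) + z * 1
      regroup = solve-∀
      collect : ∀ m x y z → x * 1 + y * m + z * 1 ≡ (x + m * y + z) * 1
      collect = solve-∀

    -- Inside a block the recurrence is that of the block (0, 0) scaled by a_{I,J}; on
    -- the first row or column of a block the neighbours in the previous block
    -- contribute through row or column q, where the boundary relations collapse them.
    entry-lucas : ∀ I r J s → r < p → s < p → e (r + I * p) (s + J * p) ≈ e I J * e r s
    entry-lucas zero    zero    J       s       _     _     = ≈-refl
    entry-lucas I       r       zero    zero    _     _     = ≈-reflexive (begin
      e (r + I * p) 0 ≡⟨ entry[i,0]≡1 m (r + I * p) ⟩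
      1               ≡⟨ cong₂ _*_ (entry[i,0]≡1 m I) (entry[i,0]≡1 m r) ⟨
      e I 0 * e r 0   ∎)
      where open ≡-Reasoning
    entry-lucas I       (suc r) J       (suc s) 1+r<p 1+s<p = ≈-trans
      (entry-recurrence-≈ (r + I * p) (s + J * p) (entry-lucas I r J (suc s) (<⇒≤ 1+r<p) 1+s<p)
                                                  (entry-lucas I r J s (<⇒≤ 1+r<p) (<⇒≤ 1+s<p))
                                                  (entry-lucas I (suc r) J s 1+r<p (<⇒≤ 1+s<p)))
      (≈-reflexive (factor m (e I J) (e r (suc s)) (e r s) (e (suc r) s)))
      where
      factor : ∀ m c x y z → c * x + m * (c * y) + c * z ≡ c * (x + m * y + z)
      factor = solve-∀
    entry-lucas I       (suc r) (suc J) zero    1+r<p _     = ≈-trans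
      (entry-recurrence-≈ (r + I * p) (q + J * p) (entry-lucas I r (suc J) zero (<⇒≤ 1+r<p) z<s)
                                                  (entry-lucas I r J q (<⇒≤ 1+r<p) q<p)
                                                  (entry-lucas I (suc r) J q 1+r<p q<p))
      (column-boundary 1+r<p (e I (suc J)) (e I J))
    entry-lucas (suc I) zero    J       (suc s) _     1+s<p = ≈-trans
      (entry-recurrence-≈ (q + I * p) (s + J * p) (entry-lucas I q J (suc s) q<p 1+s<p)
                                                  (entry-lucas I q J s q<p (<⇒≤ 1+s<p))
                                                  (entry-lucas (suc I) zero J s z<s (<⇒≤ 1+s<p)))
      (row-boundary 1+s<p (e (suc I) J) (e I J))
    entry-lucas (suc I) zero    (suc J) zero    _     _     = ≈-trans
      (entry-recurrence-≈ (q + I * p) (q + J * p) (entry-lucas I q (suc J) zero q<p z<s)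
                                                  (entry-lucas I q J q q<p q<p)
                                                  (entry-lucas (suc I) zero J q z<s q<p))
      (corner-boundary (e I (suc J)) (e I J) (e (suc I) J))

    entry-lucas-divmod : ∀ i j → e i j ≈ e (i / p) (j / p) * e (i % p) (j % p)
    entry-lucas-divmod i j =
      subst₂ (λ x y → e x y ≈ e (i / p) (j / p) * e (i % p) (j % p))
             (sym (m≡m%n+[m/n]*n i p)) (sym (m≡m%n+[m/n]*n j p))
             (entry-lucas (i / p) (i % p) (j / p) (j % p) (m%n<n i p) (m%n<n j p))

    private
      D : Fin p → Fin p → Bool
      D = nonzeroPattern p m

    p∣entry[i%p,j%p]⇔D≡false : ∀ i j → p ∣ e (i % p) (j % p) ⇔ D (i mod p) (j mod p) ≡ false
    p∣entry[i%p,j%p]⇔D≡false i j =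
      subst₂ (λ x y → p ∣ e x y ⇔ D (i mod p) (j mod p) ≡ false)
             (toℕ-fromℕ< (m%n<n i p)) (toℕ-fromℕ< (m%n<n j p))
             (⇔-sym (isNo≡false⇔ (p ∣? e (toℕ (i mod p)) (toℕ (j mod p)))))

    p∣entry⇔kronPow≡false : (d : ℕ) → 1 ≤ d → (i j : ℕ) → i < p ^ d → j < p ^ d →
                            p ∣ e i j ⇔ kronPow p D d i j ≡ false
    p∣entry⇔kronPow≡false 1 _ i j i<p^1 j<p^1 = begin
      p ∣ e i j                         ≡⟨ cong₂ (λ x y → p ∣ e x y) (m<n⇒m%n≡m (below i<p^1)) (m<n⇒m%n≡m (below j<p^1)) ⟨
      p ∣ e (i % p) (j % p)             ≈⟨ p∣entry[i%p,j%p]⇔D≡false i j ⟩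
      (D (i mod p) (j mod p) ≡ false)   ∎
      where
      open SetoidReasoning (⇔-setoid 0ℓ)
      below : ∀ {x} → x < p ^ 1 → x < p
      below {x} = subst (x <_) (*-identityʳ p)
    p∣entry⇔kronPow≡false (suc (suc d)) _ i j i<p^d j<p^d = begin
      p ∣ e i j                                      ≈⟨ ∣-cong-≈ (entry-lucas-divmod i j) ⟩
      p ∣ e (i / p) (j / p) * e (i % p) (j % p)      ≈⟨ prime∣*⇔ isPrime ⟩
      (p ∣ e (i / p) (j / p) ⊎ p ∣ e (i % p) (j % p)) ≈⟨ p∣entry⇔kronPow≡false (suc d) (s≤s z≤n) (i / p) (j / p) (/p<p^[1+d] i<p^d) (/p<p^[1+d] j<p^d)
                                                         ⊎-⇔ p∣entry[i%p,j%p]⇔D≡false i j ⟩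
      (K ≡ false ⊎ D (i mod p) (j mod p) ≡ false)     ≈⟨ ∧≡false⇔ ⟨
      (K ∧ D (i mod p) (j mod p) ≡ false)             ∎
      where
      open SetoidReasoning (⇔-setoid 0ℓ)
      K = kronPow p D (suc d) (i / p) (j / p)
      /p<p^[1+d] : ∀ {x} → x < p ^ suc (suc d) → x / p < p ^ suc d
      /p<p^[1+d] {x} x<p^d = m<n*o⇒m/o<n (subst (x <_) (*-comm p (p ^ suc d)) x<p^d)

-- A vanishing entry in row 1

odd⇒n≡1+[n/2]*2 : ∀ n → ¬ 2 ∣ n → n ≡ suc (n / 2 * 2)
odd⇒n≡1+[n/2]*2 n ¬2∣n with n % 2 | m%n<n n 2 | m≡m%n+[m/n]*n n 2 | ¬2∣n ∘ m%n≡0⇒n∣m n 2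
... | 0           | _            | _  | n%2≢0 = contradiction refl n%2≢0
... | 1           | _            | n≡ | _     = n≡
... | suc (suc _) | s≤s (s≤s ()) | _  | _

∃k<p[p∣entry[1,k]] : ∀ {q} m → m ≡ 0 ⊎ (¬ 2 ∣ suc q × m ≡ 1) → ∃[ k ] (k < suc q × suc q ∣ entry m 1 k)
∃k<p[p∣entry[1,k]] {q} .0 (inj₁ refl) =
  q , n<1+n q , ∣-reflexive (sym (trans (entry[1,j]≡1+j*[1+m] 0 q) (cong suc (*-identityʳ q))))
∃k<p[p∣entry[1,k]] {q} .1 (inj₂ (¬2∣p , refl)) =
  k , k<p , ∣-reflexive (trans p≡1+k*2 (sym (entry[1,j]≡1+j*[1+m] 1 k)))
  where
  k = suc q / 2
  p≡1+k*2 = odd⇒n≡1+[n/2]*2 (suc q) ¬2∣p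
  k<p : k < suc q
  k<p = subst (k <_) (sym p≡1+k*2) (s≤s (m≤m*n k 2))

corollary3p11 : (p : ℕ) .{{_ : NonZero p}} → Prime p → (m : ℕ) →
    (m ≡ 0 ⊎ (¬ (2 ∣ p) × m ≡ 1)) →
    ∃[ D ] (
      (∃[ i ] ∃[ j ] D i j ≡ false) ×
      (∃[ i ] ∃[ j ] ∃[ i′ ] ∃[ j′ ]
        (¬ ((i ≡ i′) × (j ≡ j′)) × D i j ≡ true × D i′ j′ ≡ true)) ×
      ((d : ℕ) → 1 ≤ d → (i j : ℕ) → i < p ^ d → j < p ^ d →
        ((p ∣ entry m i j) ⇔ (kronPow p D d i j ≡ false))))
corollary3p11 0 ()
corollary3p11 1 ()
corollary3p11 p@(suc (suc q)) isPrime m m≡0⊎[odd×m≡1] =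
  nonzeroPattern p m , zeroEntry , (fzero , fzero , fzero , fsuc fzero , (λ { (_ , ()) }) , firstRow fzero , firstRow (fsuc fzero)) ,
  p∣entry⇔kronPow≡false isPrime m
  where
  zeroEntry : ∃[ i ] ∃[ j ] nonzeroPattern p m i j ≡ false
  zeroEntry with k , k<p , p∣entry[1,k] ← ∃k<p[p∣entry[1,k]] m m≡0⊎[odd×m≡1] =
    fsuc fzero , fromℕ< k<p ,
    Equivalence.from (isNo≡false⇔ _) (subst (λ x → p ∣ entry m 1 x) (sym (toℕ-fromℕ< k<p)) p∣entry[1,k])
  firstRow : ∀ s → nonzeroPattern p m fzero s ≡ true
  firstRow s = isNo≡true (p ∣? 1) (λ p∣1 → case ∣1⇒≡1 {p} p∣1 of λ ())
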